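{- $\mathsf{g}_{\pm}(C_2\oplus C_4)=5$.
   Context: For a finite abelian group $G$ (written additively), $\exp(G)$ denotes its exponent and $C_m$ a cyclic group of order $m$. The plus-minus weighted Harborth constant $\mathsf{g}_{\pm}(G)$ is the smallest $\ell\in\mathbb{N}$ such that for every subset $S\subseteq G$ with $|S|\ge\ell$ there exist $\exp(G)$ distinct elements $g_1,\dots,g_{\exp(G)}\in S$ and signs $\varepsilon_i\in\{+1,-1\}$ with $\sum_i\varepsilon_ig_i=0$. -}

module Defs where

open import Data.Nat using (ℕ; zero; suc; _≤_; _∸_)
open import Data.Nat.DivMod using (_mod_)
open import Data.Fin using (Fin; toℕ)
open import Data.Product using (_×_; _,_; Σ)
open import Data.List using (List; length)
open import Data.List.Membership.Propositional using (_∈_)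
open import Data.List.Relation.Unary.Unique.Propositional using (Unique)
open import Data.Sign using (Sign)
open import Function.Definitions using (Injective)
open import Relation.Binary.PropositionalEquality using (_≡_)

module Cyclic (m : ℕ) where
  addC : Fin (suc m) → Fin (suc m) → Fin (suc m)
  addC a b = (toℕ a Data.Nat.+ toℕ b) mod (suc m)

  negC : Fin (suc m) → Fin (suc m)
  negC a = (suc m ∸ toℕ a) mod (suc m)

  zeroC : Fin (suc m)
  zeroC = Fin.zero

G : Set
G = Fin 2 × Fin 4

_+G_ : G → G → G
(a , b) +G (c , d) = Cyclic.addC 1 a c , Cyclic.addC 3 b d

-G_ : G → G
-G (a , b) = Cyclic.negC 1 a , Cyclic.negC 3 b

0G : G
0G = Fin.zero , Fin.zero

-- exp(C_2 ⊕ C_4) = lcm(2,4) = 4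
expG : ℕ
expG = 4

signed : Sign → G → G
signed Sign.+ g = g
signed Sign.- g = -G g

sumG : {k : ℕ} → (Fin k → G) → G
sumG {zero} f = 0G
sumG {suc k} f = f Fin.zero +G sumG {k} (λ i → f (Fin.suc i))

HasPMZeroSum : List G → Set
HasPMZeroSum S =
  Σ (Fin expG → G) λ g →
    Injective _≡_ _≡_ g ×
    (∀ i → g i ∈ S) ×
    Σ (Fin expG → Sign) λ ε → sumG (λ i → signed (ε i) (g i)) ≡ 0G

-- Subsets of G are duplicate-free lists; |S| = length S.
PMProperty : ℕ → Set
PMProperty ℓ = (S : List G) → Unique S → ℓ ≤ length S → HasPMZeroSum S

IsPMHarborth : ℕ → Set
IsPMHarborth ℓ = PMProperty ℓ × ((m : ℕ) → PMProperty m → ℓ ≤ m)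

module Submission where

-- G has only eight elements, so both bounds are finite verifications.  Among any five
-- distinct elements of G, leaving out a suitable one gives four elements with a
-- plus-minus zero-sum.  On the other hand a witness inside S₀ = {0, (0,1), (0,2), (1,0)}
-- must use all four elements, and then the first coordinate of the signed sum is 1
-- whatever the signs, so S₀ shows that four elements do not suffice.

open import Defs
open import Data.Bool using (Bool; true)
open import Data.Bool.ListAction using (all)
open import Data.Bool.Properties using (T-≡)
open import Data.Fin using (Fin; zero; suc; punchIn) renaming (_≟_ to _≟F_)
open import Data.Fin.Properties using (all?; punchIn-injective) renaming (any? to anyFin?)
open import Data.List using (List; []; _∷_; length; lookup; allFin; cartesianProduct)
open import Data.List.Membership.Propositional using (_∈_; find; lose)
open import Data.List.Membership.Propositional.Properties using (∈-lookup; ∈-allFin; ∈-cartesianProduct⁺)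
open import Data.List.Relation.Binary.Subset.Propositional.Properties using (xs⊆xs++ys)
open import Data.List.Relation.Unary.All as All using (All)
open import Data.List.Relation.Unary.All.Properties using (all⁺)
open import Data.List.Relation.Unary.AllPairs using (_∷_)
open import Data.List.Relation.Unary.Any using (Any; any?; here; there)
open import Data.List.Relation.Unary.Unique.DecPropositional using (unique?)
open import Data.List.Relation.Unary.Unique.Propositional using (Unique)
open import Data.List.Relation.Unary.Unique.Propositional.Properties using (take⁺)
open import Data.Nat using (ℕ; _<_; _≤?_; s≤s)
open import Data.Nat.Properties using (≰⇒>)
open import Data.Product using (Σ; ∃; _,_; _×_)
open import Data.Product.Properties using (≡-dec)
open import Data.Sign using (Sign)
open import Data.Vec.Functional as Vec using (Vector; tail)
open import Function using (_∘_; Equivalence)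
open import Function.Definitions using (Injective)
open import Relation.Binary.Definitions using (DecidableEquality)
open import Relation.Binary.PropositionalEquality using (_≡_; refl; sym; trans; cong; cong₂; _≗_)
open import Relation.Nullary using (Dec; yes; no; ¬_; contradiction; does)
open import Relation.Nullary.Decidable using (map′; _×-dec_; _→-dec_; from-yes; from-no)
open import Relation.Unary using (Decidable)

does-true⇒ : ∀ {p} {P : Set p} (P? : Dec P) → does P? ≡ true → P
does-true⇒ (yes p) _ = p

module _ {a} {A : Set a} where

  all-∈ : ∀ {p : A → Bool} {xs x} → all p xs ≡ true → x ∈ xs → p x ≡ true
  all-∈ {p} {xs} h x∈xs = Equivalence.to T-≡ (All.lookup (all⁺ p xs (Equivalence.from T-≡ h)) x∈xs)

  ∷-cong : ∀ {n} x {f g : Vector A n} → f ≗ g → x Vec.∷ f ≗ x Vec.∷ g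
  ∷-cong x f≗g zero    = refl
  ∷-cong x f≗g (suc i) = f≗g i

  head-∷-tail : ∀ {n} (f : Vector A (ℕ.suc n)) → f zero Vec.∷ tail f ≗ f
  head-∷-tail f zero    = refl
  head-∷-tail f (suc i) = refl

  ∃-vectorOver? : ∀ {n p} (xs : List A) {P : Vector A n → Set p} → (∀ {f g} → f ≗ g → P f → P g) →
                  Decidable P → Dec (∃ λ f → (∀ i → f i ∈ xs) × P f)
  ∃-vectorOver? {ℕ.zero} xs {P} resp P? = map′ (λ p → Vec.[] , (λ ()) , p) from (P? Vec.[])
    where
    from : (∃ λ f → (∀ i → f i ∈ xs) × P f) → P Vec.[]
    from (f , _ , p) = resp {f} (λ ()) p
  ∃-vectorOver? {ℕ.suc n} xs {P} resp P? =
    map′ to from (any? (λ x → ∃-vectorOver? xs (resp ∘ ∷-cong x) (P? ∘ (x Vec.∷_))) xs)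
    where
    to : Any (λ x → ∃ λ f → (∀ i → f i ∈ xs) × P (x Vec.∷ f)) xs → ∃ λ f → (∀ i → f i ∈ xs) × P f
    to any with find any
    ... | x , x∈xs , f , f∈xs , p = x Vec.∷ f , (λ { zero → x∈xs ; (suc i) → f∈xs i }) , p
    from : (∃ λ f → (∀ i → f i ∈ xs) × P f) → Any (λ x → ∃ λ f → (∀ i → f i ∈ xs) × P (x Vec.∷ f)) xs
    from (f , f∈xs , p) = lose (f∈xs zero) (tail f , f∈xs ∘ suc , resp (sym ∘ head-∷-tail f) p)

  -- A Boolean test rather than a Dec-valued one: the type checker evaluates it in
  -- exhaustive checks far faster and in far less memory.
  allVectorsOver : List A → (n : ℕ) → (Vector A n → Bool) → Bool
  allVectorsOver xs ℕ.zero    p = p Vec.[]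
  allVectorsOver xs (ℕ.suc n) p = all (λ x → allVectorsOver xs n (p ∘ (x Vec.∷_))) xs

  ∀-vectorOver : ∀ {n p} (xs : List A) {P : Vector A n → Set p} → (∀ {f g} → f ≗ g → P f → P g) →
                 (P? : Decidable P) → allVectorsOver xs n (does ∘ P?) ≡ true →
                 ∀ f → (∀ i → f i ∈ xs) → P f
  ∀-vectorOver {ℕ.zero}  xs resp P? h f _    = resp (λ ()) (does-true⇒ (P? Vec.[]) h)
  ∀-vectorOver {ℕ.suc n} xs resp P? h f f∈xs =
    resp (head-∷-tail f)
      (∀-vectorOver xs (resp ∘ ∷-cong (f zero)) (P? ∘ (f zero Vec.∷_)) (all-∈ h (f∈xs zero)) (tail f) (f∈xs ∘ suc))

  injective? : DecidableEquality A → ∀ {n} (f : Vector A n) → Dec (Injective _≡_ _≡_ f)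
  injective? _≟_ f = map′ (λ inj {i} {j} → inj i j) (λ inj i j → inj)
    (all? λ i → all? λ j → (f i ≟ f j) →-dec (i ≟F j))

  injective-resp-≗ : ∀ {n} {f g : Vector A n} → f ≗ g → Injective _≡_ _≡_ f → Injective _≡_ _≡_ g
  injective-resp-≗ f≗g inj {i} {j} gi≡gj = inj (trans (f≗g i) (trans gi≡gj (sym (f≗g j))))

  lookup-injective : ∀ {xs : List A} → Unique xs → Injective _≡_ _≡_ (lookup xs)
  lookup-injective             (_  ∷ _) {zero}  {zero}  _  = refl
  lookup-injective             (x∉ ∷ _) {zero}  {suc j} eq = contradiction eq (All.lookup x∉ (∈-lookup j))
  lookup-injective             (x∉ ∷ _) {suc i} {zero}  eq = contradiction (sym eq) (All.lookup x∉ (∈-lookup i))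
  lookup-injective {_ ∷ _ ∷ _} (_  ∷ u) {suc i} {suc j} eq = cong suc (lookup-injective u eq)

_≟G_ : DecidableEquality G
_≟G_ = ≡-dec _≟F_ _≟F_

elementsG : List G
elementsG = cartesianProduct (allFin 2) (allFin 4)

∈-elementsG : ∀ x → x ∈ elementsG
∈-elementsG (a , b) = ∈-cartesianProduct⁺ (∈-allFin a) (∈-allFin b)

signs : List Sign
signs = Sign.+ ∷ Sign.- ∷ []

∈-signs : ∀ s → s ∈ signs
∈-signs Sign.+ = here refl
∈-signs Sign.- = there (here refl)

sumG-cong : ∀ {k} {f g : Fin k → G} → f ≗ g → sumG f ≡ sumG g
sumG-cong {ℕ.zero}  f≗g = refl
sumG-cong {ℕ.suc k} f≗g = cong₂ _+G_ (f≗g zero) (sumG-cong (f≗g ∘ suc))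

SignedZeroSum : ∀ {k} → Vector G k → Set
SignedZeroSum g = Σ (Vector Sign _) λ ε → sumG (λ i → signed (ε i) (g i)) ≡ 0G

signedZeroSum-resp-≗ : ∀ {k} {f g : Vector G k} → f ≗ g → SignedZeroSum f → SignedZeroSum g
signedZeroSum-resp-≗ f≗g (ε , z) = ε , trans (sym (sumG-cong (cong (signed (ε _)) ∘ f≗g))) z

signedZeroSum? : ∀ {k} (g : Vector G k) → Dec (SignedZeroSum g)
signedZeroSum? g = map′ (λ (ε , _ , z) → ε , z) (λ (ε , z) → ε , ∈-signs ∘ ε , z)
  (∃-vectorOver? signs resp (λ ε → sumG (λ i → signed (ε i) (g i)) ≟G 0G))
  where
  resp : ∀ {ε ε′} → ε ≗ ε′ → sumG (λ i → signed (ε i) (g i)) ≡ 0G → sumG (λ i → signed (ε′ i) (g i)) ≡ 0G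
  resp ε≗ε′ z = trans (sym (sumG-cong (λ i → cong₂ signed (ε≗ε′ i) refl))) z

PMZeroSumFamily : Vector G expG → Set
PMZeroSumFamily g = Injective _≡_ _≡_ g × SignedZeroSum g

hasPMZeroSum? : (S : List G) → Dec (HasPMZeroSum S)
hasPMZeroSum? S = map′ to from (∃-vectorOver? S resp (λ g → injective? _≟G_ g ×-dec signedZeroSum? g))
  where
  resp : ∀ {f g} → f ≗ g → PMZeroSumFamily f → PMZeroSumFamily g
  resp f≗g (inj , z) = injective-resp-≗ f≗g inj , signedZeroSum-resp-≗ f≗g z
  to : (∃ λ g → (∀ i → g i ∈ S) × PMZeroSumFamily g) → HasPMZeroSum S
  to (g , g∈S , inj , z) = g , inj , g∈S , z
  from : HasPMZeroSum S → ∃ λ g → (∀ i → g i ∈ S) × PMZeroSumFamily g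
  from (g , inj , g∈S , z) = g , g∈S , inj , z

OmitOneZeroSum : Vector G 5 → Set
OmitOneZeroSum v = ∃ λ i → SignedZeroSum (v ∘ punchIn i)

omitOneZeroSum-resp-≗ : ∀ {f g : Vector G 5} → f ≗ g → OmitOneZeroSum f → OmitOneZeroSum g
omitOneZeroSum-resp-≗ f≗g (i , z) = i , signedZeroSum-resp-≗ (f≗g ∘ punchIn i) z

-- The refl below runs the check over all 8⁵ vectors.
injective⇒omitOneZeroSum : (v : Vector G 5) → Injective _≡_ _≡_ v → OmitOneZeroSum v
injective⇒omitOneZeroSum v = ∀-vectorOver elementsG resp omitOne? refl v (∈-elementsG ∘ v)
  where
  omitOne? : (w : Vector G 5) → Dec (Injective _≡_ _≡_ w → OmitOneZeroSum w)
  omitOne? w = injective? _≟G_ w →-dec anyFin? (signedZeroSum? ∘ (w ∘_) ∘ punchIn)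
  resp : ∀ {f g} → f ≗ g → (Injective _≡_ _≡_ f → OmitOneZeroSum f) → Injective _≡_ _≡_ g → OmitOneZeroSum g
  resp f≗g h = omitOneZeroSum-resp-≗ f≗g ∘ h ∘ injective-resp-≗ (sym ∘ f≗g)

omitOneZeroSum⇒hasPMZeroSum : ∀ {S} (v : Vector G 5) → Injective _≡_ _≡_ v → (∀ i → v i ∈ S) →
                              OmitOneZeroSum v → HasPMZeroSum S
omitOneZeroSum⇒hasPMZeroSum v inj v∈S (i , z) = v ∘ punchIn i , punchIn-injective i _ _ ∘ inj , v∈S ∘ punchIn i , z

pmProperty-5 : PMProperty 5
pmProperty-5 (a ∷ b ∷ c ∷ d ∷ e ∷ rest) S-unique _ =
  omitOneZeroSum⇒hasPMZeroSum v v-injective (xs⊆xs++ys (a ∷ b ∷ c ∷ d ∷ e ∷ []) rest ∘ ∈-lookup)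
    (injective⇒omitOneZeroSum v v-injective)
  where
  v = lookup (a ∷ b ∷ c ∷ d ∷ e ∷ [])
  v-injective = lookup-injective (take⁺ 5 S-unique)
pmProperty-5 []                   _ ()
pmProperty-5 (_ ∷ [])             _ (s≤s ())
pmProperty-5 (_ ∷ _ ∷ [])         _ (s≤s (s≤s ()))
pmProperty-5 (_ ∷ _ ∷ _ ∷ [])     _ (s≤s (s≤s (s≤s ())))
pmProperty-5 (_ ∷ _ ∷ _ ∷ _ ∷ []) _ (s≤s (s≤s (s≤s (s≤s ()))))

pmProperty⇒length< : ∀ {ℓ S} → PMProperty ℓ → Unique S → ¬ HasPMZeroSum S → length S < ℓ
pmProperty⇒length< {ℓ} {S} P S-unique noZeroSum with ℓ ≤? length S
... | yes ℓ≤|S| = contradiction (P S S-unique ℓ≤|S|) noZeroSum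
... | no  ℓ≰|S| = ≰⇒> ℓ≰|S|

S₀ : List G
S₀ = (zero , zero) ∷ (zero , suc zero) ∷ (zero , suc (suc zero)) ∷ (suc zero , zero) ∷ []

lemma5p5 : IsPMHarborth 5
lemma5p5 = pmProperty-5 , λ ℓ P → pmProperty⇒length< P (from-yes (unique? _≟G_ S₀)) (from-no (hasPMZeroSum? S₀))
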